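{- Let $\mathcal{M}=(S,I,\to,\Pi,\langle\!\langle\cdot\rangle\!\rangle)$ be a labelled transition system with $k$-bounded branching, and let $\sigma_1,\dots,\sigma_k\colon S\to S$ be functions with $\to\;=\;\bigcup_{i=1}^k\sigma_i$. Let $C$ be a finite set, $\Theta$ and $H$ arbitrary sets, $f\colon\Theta\times S\to C$ a label-preserving state classifier template and $r\colon H\times S\times S\to\mathbb{N}$ a function (writing $f_\theta(s)=f(\theta,s)$, $r_\eta(s,t)=r(\eta,s,t)$). Define $$\Psi(\theta,\eta,s,t)=\bigwedge_{i=1}^k\Big(\bigvee_{j=1}^k f_\theta(\sigma_i(s))=f_\theta(\sigma_j(t))\;\lor\;\big(f_\theta(s)=f_\theta(\sigma_i(s))\land r_\eta(\sigma_i(s),\sigma_i(s))<r_\eta(s,s)\big)\;\lor\;\bigvee_{j=1}^k\big(f_\theta(t)=f_\theta(\sigma_j(t))\land r_\eta(\sigma_i(s),\sigma_j(t))<r_\eta(\sigma_i(s),t)\big)\Big).$$ Suppose there exist $\theta\in\Theta$ and $\eta\in H$ such that for all $s,t\in S$, $f_\theta(s)=f_\theta(t)$ implies $\Psi(\theta,\eta,s,t)$. Then the partition $\simeq_{f_\theta}=\{(s,t)\mid f_\theta(s)=f_\theta(t)\}$ is a stutter-insensitive bisimulation on $\mathcal{M}$.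
   Context: A labelled transition system $\mathcal{M}$ consists of a countable state space $S$, an initial region $I\subseteq S$, a transition relation $\to\subseteq S\times S$, a set of atomic propositions $\Pi$, and a labelling function $\langle\!\langle\cdot\rangle\!\rangle\colon S\to\mathcal{P}(\Pi)$. It has $k$-bounded branching if every state $s$ satisfies $0<|\{t: s\to t\}|\le k$. A function $g\colon S\to C$ is label-preserving if $g(s)=g(t)$ implies $\langle\!\langle s\rangle\!\rangle=\langle\!\langle t\rangle\!\rangle$; the template $f$ is label-preserving if $f_\theta$ is label-preserving for every $\theta\in\Theta$. A path is an infinite sequence $s_0s_1\dots$ with $s_i\to s_{i+1}$; $\mathrm{Paths}(s)$ is the set of paths starting at $s$. A partition is an equivalence relation on $S$, label-preserving if related states have equal labels. A label-preserving partition $\simeq$ is a stutter-insensitive bisimulation if for all $s\simeq s'$ and every $\pi\in\mathrm{Paths}(s)$ there is $\pi'\in\mathrm{Paths}(s')$ such that $\pi$ and $\pi'$ split into equally many consecutive non-empty finite subsequences $\pi=B_1B_2\dots$, $\pi'=B_1'B_2'\dots$ with $t\simeq t'$ for all $i$, $t\in B_i$, $t'\in B_i'$. -}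

module Defs where

open import Data.Nat using (ℕ; _<_; _≤_)
open import Data.Fin using (Fin)
open import Data.Product using (Σ; ∃; ∃-syntax; _×_; _,_)
open import Data.Sum using (_⊎_)
open import Function.Bundles using (_↣_; _↔_; _⇔_)
open import Relation.Binary.PropositionalEquality using (_≡_)
open import Relation.Binary.Structures using (IsEquivalence)

-- A labelled transition system (S, I, →, Π, ⟨⟨·⟩⟩).
-- Subsets of Π (labels) are predicates Π → Set; the state space is countable
-- (witnessed by an injection into ℕ).
record LTS : Set₁ where
  field
    S         : Set
    countable : S ↣ ℕ
    I         : S → Set
    _⟶_       : S → S → Set
    Π         : Set
    lab       : S → Π → Set

_≐_ : {Π : Set} → (Π → Set) → (Π → Set) → Set
A ≐ B = ∀ p → (A p → B p) × (B p → A p)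

module _ (M : LTS) where
  open LTS M

  -- |{t : s → t}| ≤ k, i.e. the successor set is covered by k elements.
  AtMostSuccs : ℕ → S → Set
  AtMostSuccs k s = Σ (Fin k → S) λ g →
    (∀ i → s ⟶ g i) × (∀ t → s ⟶ t → ∃[ i ] g i ≡ t)

  BoundedBranching : ℕ → Set
  BoundedBranching k = ∀ s → (∃[ t ] s ⟶ t) × AtMostSuccs k s

  LabelPreserving : {C : Set} → (S → C) → Set
  LabelPreserving g = ∀ s t → g s ≡ g t → lab s ≐ lab t

  LabelPreservingTemplate : {Θ C : Set} → (Θ → S → C) → Set
  LabelPreservingTemplate f = ∀ θ → LabelPreserving (f θ)

  IsPath : (ℕ → S) → Set
  IsPath π = ∀ n → π n ⟶ π (ℕ.suc n)
    where import Data.Nat as ℕ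

  PathFrom : S → (ℕ → S) → Set
  PathFrom s π = (π 0 ≡ s) × IsPath π

  -- A splitting of an infinite sequence into consecutive non-empty finite
  -- blocks: block i consists of the positions m with b i ≤ m < b (i+1).
  Splitting : (ℕ → ℕ) → Set
  Splitting b = (b 0 ≡ 0) × (∀ i → b i < b (Data.Nat.suc i))
    where import Data.Nat

  InBlock : (ℕ → ℕ) → ℕ → ℕ → Set
  InBlock b i m = (b i ≤ m) × (m < b (Data.Nat.suc i))
    where import Data.Nat

  LabelPreservingPartition : (S → S → Set) → Set
  LabelPreservingPartition _≃_ =
    IsEquivalence _≃_ × (∀ s t → s ≃ t → lab s ≐ lab t)

  StutterBisim : (S → S → Set) → Set
  StutterBisim _≃_ = LabelPreservingPartition _≃_ ×
    (∀ s s' → s ≃ s' → ∀ π → PathFrom s π →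
      Σ (ℕ → S) λ π' → PathFrom s' π' ×
      Σ (ℕ → ℕ) λ b → Σ (ℕ → ℕ) λ b' → Splitting b × Splitting b' ×
        (∀ i m m' → InBlock b i m → InBlock b' i m' → π m ≃ π' m'))

  KernelPartition : {C : Set} → (S → C) → S → S → Set
  KernelPartition g s t = g s ≡ g t

  Ψ : {k : ℕ} {Θ H C : Set} → (Fin k → S → S) → (Θ → S → C) →
      (H → S → S → ℕ) → Θ → H → S → S → Set
  Ψ {k} σ f r θ η s t = ∀ (i : Fin k) →
      (∃[ j ] f θ (σ i s) ≡ f θ (σ j t))
    ⊎ ((f θ s ≡ f θ (σ i s)) × (r η (σ i s) (σ i s) < r η s s))
    ⊎ (∃[ j ] (f θ t ≡ f θ (σ j t)) × (r η (σ i s) (σ j t) < r η (σ i s) t))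

Finite : Set → Set
Finite C = Σ ℕ λ n → C ↔ Fin n

-- Ψ says precisely that the kernel of f_θ is a well-founded bisimulation in
-- the sense of Namjoshi, with rank r_η(s, s) for stuttering of the given path
-- and r_η(s', t) for stuttering of the matching one: a step s → s' of a path
-- from s ≃ t is answered by a matching step of t, or by s' ≃ t with the first
-- rank decreasing, or by a stuttering step t → t' with the second rank
-- decreasing.  Iterating these answers along a path π builds the matching path
-- π' one step at a time, each step of π' consuming a (possibly empty) segment
-- of π.  The first rank makes every answer finite; the second forbids π' from
-- consuming empty segments forever, so cutting π' into maximal runs that
-- consume nothing followed by one consuming step yields the blocks.
module Submission where

open import Defs
open import Data.Nat using (ℕ; zero; suc; _<_; _≤_; s≤s; s≤s⁻¹)
open import Data.Nat.Properties using (≤-refl; ≤-reflexive; ≤-antisym; <⇒≤; ≤⇒≯; m≤n⇒m<n∨m≡n)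
open import Data.Nat.Induction using (<-wellFounded)
open import Data.Empty using (⊥-elim)
open import Data.Fin using (Fin)
open import Data.Product using (∃-syntax; _×_; _,_)
open import Data.Sum using (_⊎_; inj₁; inj₂)
open import Function.Bundles using (_⇔_; Equivalence)
open import Induction.WellFounded using (Acc; acc)
open import Relation.Binary.PropositionalEquality as ≡ using (_≡_; refl; cong; subst)
open import Relation.Binary.Structures using (IsEquivalence)
import Relation.Binary.Construct.On as On

module _ (M : LTS) where
  open LTS M

  WellFoundedBisimulation : (S → S → Set) → (S → ℕ) → (S → S → ℕ) → Set
  WellFoundedBisimulation _≃_ μ ρ = ∀ {s t s'} → s ≃ t → s ⟶ s' →
      (∃[ t' ] t ⟶ t' × s' ≃ t')
    ⊎ (s' ≃ t × μ s' < μ s)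
    ⊎ (∃[ t' ] t ⟶ t' × s ≃ t' × ρ s' t' < ρ s' t)

  kernel-labelPreservingPartition : {C : Set} {g : S → C} →
    LabelPreserving M g → LabelPreservingPartition M (KernelPartition M g)
  kernel-labelPreservingPartition {g = g} g-lp = On.isEquivalence g ≡.isEquivalence , g-lp

  generator-step : {k : ℕ} (σ : Fin k → S → S) → (∀ s t → s ⟶ t ⇔ (∃[ i ] σ i s ≡ t)) →
    ∀ j s → s ⟶ σ j s
  generator-step σ σ-generates j s = Equivalence.from (σ-generates s (σ j s)) (j , refl)

  Ψ⇒wellFoundedBisimulation : {k : ℕ} {Θ H C : Set}
    (σ : Fin k → S → S) → (∀ s t → s ⟶ t ⇔ (∃[ i ] σ i s ≡ t)) →
    (f : Θ → S → C) (r : H → S → S → ℕ) (θ : Θ) (η : H) →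
    (∀ s t → f θ s ≡ f θ t → Ψ M σ f r θ η s t) →
    WellFoundedBisimulation (KernelPartition M (f θ)) (λ s → r η s s) (r η)
  Ψ⇒wellFoundedBisimulation σ σ-generates f r θ η Ψ-holds {s} {t} {s'} fs≡ft s⟶s'
    with Equivalence.to (σ-generates s s') s⟶s'
  ... | i , refl with Ψ-holds s t fs≡ft i
  ... | inj₁ (j , eq) = inj₁ (σ j t , generator-step σ σ-generates j t , eq)
  ... | inj₂ (inj₁ (eq , lt)) = inj₂ (inj₁ (≡.trans (≡.sym eq) fs≡ft , lt))
  ... | inj₂ (inj₂ (j , eq , lt)) =
    inj₂ (inj₂ (σ j t , generator-step σ σ-generates j t , ≡.trans fs≡ft eq , lt))

  module Matching {_≃_ : S → S → Set} {μ : S → ℕ} {ρ : S → S → ℕ}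
    (≃-equiv : IsEquivalence _≃_) (wfb : WellFoundedBisimulation _≃_ μ ρ)
    (π : ℕ → S) (π-path : IsPath M π) (t₀ : S) (π₀≃t₀ : π 0 ≃ t₀) where
    open IsEquivalence ≃-equiv using (sym; trans)

    -- The step t ⟶ t' of the matching path consumes the segment π n … π (n' - 1).
    record Response (n : ℕ) (t : S) : Set where
      field
        n'       : ℕ
        t'       : S
        t⟶t'     : t ⟶ t'
        related  : π n' ≃ t'
        skipped  : ∀ p → n ≤ p → p < n' → π p ≃ t
        progress : n < n' ⊎ (n' ≡ n × ρ (π (suc n)) t' < ρ (π (suc n)) t)

      n≤n' : n ≤ n'
      n≤n' with progress
      ... | inj₁ n<n'       = <⇒≤ n<n'
      ... | inj₂ (n'≡n , _) = ≤-reflexive (≡.sym n'≡n)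

    respond : ∀ n t → Acc _<_ (μ (π n)) → π n ≃ t → Response n t
    respond n t (acc rs) πn≃t with wfb πn≃t (π-path n)
    ... | inj₁ (t' , t⟶t' , related) = record
      { n' = suc n ; t' = t' ; t⟶t' = t⟶t' ; related = related
      ; skipped = only-n ; progress = inj₁ ≤-refl }
      where
      only-n : ∀ p → n ≤ p → p < suc n → π p ≃ t
      only-n p n≤p p<1+n rewrite ≤-antisym (s≤s⁻¹ p<1+n) n≤p = πn≃t
    ... | inj₂ (inj₁ (πsn≃t , μ<)) = record
      { n' = n' ; t' = t' ; t⟶t' = t⟶t' ; related = related
      ; skipped = skipped′ ; progress = inj₁ n≤n' }
      where
      open Response (respond (suc n) t (rs μ<) πsn≃t)
      skipped′ : ∀ p → n ≤ p → p < n' → π p ≃ t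
      skipped′ p n≤p p<n' with m≤n⇒m<n∨m≡n n≤p
      ... | inj₁ n<p  = skipped p n<p p<n'
      ... | inj₂ refl = πn≃t
    ... | inj₂ (inj₂ (t' , t⟶t' , πn≃t' , ρ<)) = record
      { n' = n ; t' = t' ; t⟶t' = t⟶t' ; related = πn≃t'
      ; skipped = λ p n≤p p<n → ⊥-elim (≤⇒≯ n≤p p<n) ; progress = inj₂ (refl , ρ<) }

    record Config : Set where
      constructor _,_∣_
      field
        pos   : ℕ
        state : S
        agree : π pos ≃ state
    open Config

    response : (c : Config) → Response (pos c) (state c)
    response (n , t ∣ πn≃t) = respond n t (<-wellFounded _) πn≃t

    run : ℕ → Config
    run zero    = 0 , t₀ ∣ π₀≃t₀
    run (suc m) = let open Response (response (run m)) in n' , t' ∣ related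

    N : ℕ → ℕ
    N m = pos (run m)

    π' : ℕ → S
    π' m = state (run m)

    π'-path : IsPath M π'
    π'-path m = Response.t⟶t' (response (run m))

    π'-related : ∀ q q' → N q ≡ N q' → π' q ≃ π' q'
    π'-related q q' Nq≡Nq' =
      trans (sym (agree (run q))) (subst (λ n → π n ≃ π' q') (≡.sym Nq≡Nq') (agree (run q')))

    record Block (m : ℕ) : Set where
      field
        last         : ℕ
        m≤last       : m ≤ last
        pos-const    : ∀ q → m ≤ q → q ≤ last → N q ≡ N m
        pos-advances : N m < N (suc last)

    block : ∀ m → Acc _<_ (ρ (π (suc (N m))) (π' m)) → Block m
    block m (acc rs) with Response.progress (response (run m))
    ... | inj₁ N<N' = record
      { last = m ; m≤last = ≤-refl
      ; pos-const = λ q m≤q q≤m → cong N (≤-antisym q≤m m≤q) ; pos-advances = N<N' }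
    ... | inj₂ (N'≡N , ρ<) = record
      { last = last ; m≤last = <⇒≤ m<last
      ; pos-const = pos-const′ ; pos-advances = subst (_< N (suc last)) N'≡N pos-advances }
      where
      ρ<′ : ρ (π (suc (N (suc m)))) (π' (suc m)) < ρ (π (suc (N m))) (π' m)
      ρ<′ = subst (λ n → ρ (π (suc n)) (π' (suc m)) < ρ (π (suc (N m))) (π' m)) (≡.sym N'≡N) ρ<
      open Block (block (suc m) (rs ρ<′)) renaming (m≤last to m<last)
      pos-const′ : ∀ q → m ≤ q → q ≤ last → N q ≡ N m
      pos-const′ q m≤q q≤last with m≤n⇒m<n∨m≡n m≤q
      ... | inj₁ m<q  = ≡.trans (pos-const q m<q q≤last) N'≡N
      ... | inj₂ refl = refl

    blockAt : ∀ m → Block m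
    blockAt m = block m (<-wellFounded _)

    b' : ℕ → ℕ
    b' zero    = 0
    b' (suc i) = suc (Block.last (blockAt (b' i)))

    b : ℕ → ℕ
    b i = N (b' i)

    b-splitting : Splitting M b
    b-splitting = refl , λ i → Block.pos-advances (blockAt (b' i))

    b'-splitting : Splitting M b'
    b'-splitting = refl , λ i → s≤s (Block.m≤last (blockAt (b' i)))

    blocks-related : ∀ i p q → InBlock M b i p → InBlock M b' i q → π p ≃ π' q
    blocks-related i p q (bi≤p , p<bsi) (b'i≤q , q<b'si) =
      trans (Response.skipped (response (run last)) p Nlast≤p p<bsi)
            (π'-related last q (≡.trans (pos-const last m≤last ≤-refl)
                                 (≡.sym (pos-const q b'i≤q (s≤s⁻¹ q<b'si)))))
      where
      open Block (blockAt (b' i))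
      Nlast≤p : N last ≤ p
      Nlast≤p = subst (_≤ p) (≡.sym (pos-const last m≤last ≤-refl)) bi≤p

  wellFoundedBisimulation⇒stutterBisim : {_≃_ : S → S → Set} {μ : S → ℕ} {ρ : S → S → ℕ} →
    LabelPreservingPartition M _≃_ → WellFoundedBisimulation _≃_ μ ρ → StutterBisim M _≃_
  wellFoundedBisimulation⇒stutterBisim {_≃_} partition@(≃-equiv , _) wfb =
    partition , λ s s' s≃s' π (π₀≡s , π-path) →
      let open Matching ≃-equiv wfb π π-path s' (subst (_≃ s') (≡.sym π₀≡s) s≃s')
      in π' , (refl , π'-path) , b , b' , b-splitting , b'-splitting , blocks-related

corollary1 : (M : LTS) (k : ℕ) → BoundedBranching M k →
    (σ : Fin k → LTS.S M → LTS.S M) →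
    (∀ s t → (LTS._⟶_ M s t) ⇔ (∃[ i ] σ i s ≡ t)) →
    (C Θ H : Set) → Finite C →
    (f : Θ → LTS.S M → C) → LabelPreservingTemplate M f →
    (r : H → LTS.S M → LTS.S M → ℕ) →
    (θ : Θ) (η : H) →
    (∀ s t → f θ s ≡ f θ t → Ψ M σ f r θ η s t) →
    StutterBisim M (KernelPartition M (f θ))
corollary1 M k _ σ σ-generates C Θ H _ f f-lp r θ η Ψ-holds =
  wellFoundedBisimulation⇒stutterBisim M
    (kernel-labelPreservingPartition M (f-lp θ))
    (Ψ⇒wellFoundedBisimulation M σ σ-generates f r θ η Ψ-holds)
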